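{- Let $G$ be a graph, $k\in\mathbb N$, and let $\mathcal F$ be a set of stars in $\vec S_k(G)$ all of which have finite interior. Let $X$ be a critical vertex set of $G$ with $|X|\ge k$. Then $\tau:=\{(A,B)\in\vec S_k(G):X\subseteq B\}$ is a principal $\mathcal F$-tangle of $S_k(G)$. In particular, if $\sigma\subseteq\vec S_k(G)$ is a star with $X\subseteq\mathrm{int}(\sigma)$, then $\sigma\subseteq\tau$.
   Context: A separation of $G$ is a set $\{A,B\}$ of subsets of $V(G)$ with $A\cup B=V(G)$ and no edge between $A\setminus B$ and $B\setminus A$; order $|A\cap B|$. $S_k(G)$ is the set of separations of order $<k$, $\vec S_k(G)$ the set of orientations $(A,B),(B,A)$. $(A,B)\le(C,D)$ iff $A\subseteq C$, $B\supseteq D$. An orientation of $S_k(G)$ contains exactly one orientation of each element; consistent if there are no distinct $\{A,B\},\{C,D\}$ with $(A,B)<(C,D)$, $(B,A)\in O$, $(C,D)\in O$; principal if for every $Y\subseteq V(G)$ with $|Y|<k$ some component $K$ of $G-Y$ satisfies $(V(G)\setminus V(K),V(K)\cup Y)\in O$. An $\mathcal F$-tangle of $S_k(G)$ is a consistent orientation containing no element of $\mathcal F$ as a subset. A star is a set $\sigma$ of oriented finite-order separations, not containing $(V(G),V(G))$, with $(A,B)\le(D,C)$ for all distinct $(A,B),(C,D)\in\sigma$; $\mathrm{int}(\sigma)=\bigcap_{(A,B)\in\sigma}B$. A critical vertex set of $G$ is a finite set $X\subseteq V(G)$ such that $G-X$ has infinitely many components $K$ with $N_G(K)=X$. -}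

module Defs where

open import Level using (0ℓ; Level) renaming (suc to lsuc)
open import Data.Nat using (ℕ; _<_; _≥_)
open import Data.Fin using (Fin)
open import Data.List using (List)
open import Data.List.Membership.Propositional using () renaming (_∈_ to _∈L_)
open import Data.Product using (Σ; ∃; _×_; _,_)
open import Data.Sum using (_⊎_)
open import Data.Empty using (⊥)
open import Relation.Nullary using (¬_)
open import Relation.Binary.PropositionalEquality using (_≡_; _≢_)
open import Function.Definitions using (Injective)
open import Relation.Unary using (Pred; _∈_; _⊆_; _∩_; _∪_; ∁; U)

record Graph : Set₁ where
  field
    V     : Set
    E     : V → V → Set
    sym   : ∀ {u v} → E u v → E v u
    irrfl : ∀ {v} → ¬ E v v

VSet : Graph → Set₁
VSet G = Pred (Graph.V G) 0ℓ

module _ (G : Graph) where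
  open Graph G

  _≐_ : VSet G → VSet G → Set
  A ≐ B = (A ⊆ B) × (B ⊆ A)

  HasSize : VSet G → ℕ → Set
  HasSize A n = Σ (Fin n → V) λ f → Injective _≡_ _≡_ f × (∀ v → (v ∈ A → ∃ λ i → f i ≡ v) × (∀ i → f i ≡ v → v ∈ A))

  Finite : ∀ {ℓ} → Pred V ℓ → Set ℓ
  Finite A = Σ (List V) λ xs → ∀ v → v ∈ A → v ∈L xs

  IsSep : VSet G → VSet G → Set
  IsSep A B = (∀ v → v ∈ A ⊎ v ∈ B)
            × (∀ u v → u ∈ A → ¬ (u ∈ B) → v ∈ B → ¬ (v ∈ A) → ¬ E u v)

  FiniteOrder : VSet G → VSet G → Set
  FiniteOrder A B = ∃ λ n → HasSize (A ∩ B) n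

  OrderLt : VSet G → VSet G → ℕ → Set
  OrderLt A B k = ∃ λ n → n < k × HasSize (A ∩ B) n

  InSk : ℕ → VSet G → VSet G → Set
  InSk k A B = IsSep A B × OrderLt A B k

  OSepSet : Set₁
  OSepSet = VSet G → VSet G → Set

  _≤S_ : (VSet G × VSet G) → (VSet G × VSet G) → Set
  (A , B) ≤S (C , D) = (A ⊆ C) × (D ⊆ B)

  _≐S_ : (VSet G × VSet G) → (VSet G × VSet G) → Set
  (A , B) ≐S (C , D) = (A ≐ C) × (B ≐ D)

  _<S_ : (VSet G × VSet G) → (VSet G × VSet G) → Set
  p <S q = (p ≤S q) × ¬ (p ≐S q)

  DistinctSep : VSet G → VSet G → VSet G → VSet G → Set
  DistinctSep A B C D = ¬ ((A , B) ≐S (C , D)) × ¬ ((A , B) ≐S (D , C))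

  IsOrientation : ℕ → OSepSet → Set₁
  IsOrientation k O =
      (∀ A B → O A B → InSk k A B)
    × (∀ A B C D → O A B → A ≐ C → B ≐ D → O C D)
    × (∀ A B → InSk k A B → (O A B ⊎ O B A) × (O A B → O B A → A ≐ B))

  Consistent : OSepSet → Set₁
  Consistent O = ∀ A B C D → DistinctSep A B C D → (A , B) <S (C , D) → O B A → O C D → ⊥

  data PathIn (S : VSet G) : V → V → Set where
    here : ∀ {u} → u ∈ S → PathIn S u u
    step : ∀ {u w v} → u ∈ S → E u w → PathIn S w v → PathIn S u v

  IsComponent : VSet G → VSet G → Set
  IsComponent Y K =
      (K ⊆ ∁ Y)
    × (∃ λ v → v ∈ K)
    × (∀ u v → u ∈ K → v ∈ K → PathIn (∁ Y) u v)
    × (∀ u v → u ∈ K → PathIn (∁ Y) u v → v ∈ K)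

  Nbhd : VSet G → VSet G
  Nbhd K v = ¬ (v ∈ K) × (∃ λ u → u ∈ K × E u v)

  Principal : ℕ → OSepSet → Set₁
  Principal k O = ∀ Y → (∃ λ n → n < k × HasSize Y n) →
    Σ (VSet G) λ K → IsComponent Y K × O (∁ K) (K ∪ Y)

  IsStar : OSepSet → Set₁
  IsStar σ =
      (∀ A B → σ A B → IsSep A B × FiniteOrder A B)
    × (∀ A B → σ A B → A ≐ U → B ≐ U → ⊥)
    × (∀ A B C D → σ A B → σ C D → ¬ ((A , B) ≐S (C , D)) → (A , B) ≤S (D , C))

  int : OSepSet → Pred V (lsuc 0ℓ)
  int σ v = ∀ A B → σ A B → v ∈ B

  IsFTangle : ℕ → (OSepSet → Set) → OSepSet → Set₁
  IsFTangle k F O = IsOrientation k O × Consistent O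
    × (∀ σ → F σ → ¬ (∀ A B → σ A B → O A B))

  Critical : VSet G → Set₁
  Critical X = Finite X ×
    (∀ n → Σ (Fin n → VSet G) λ Ks →
        (∀ i → IsComponent X (Ks i) × (Nbhd (Ks i) ≐ X))
      × (∀ i j → i ≢ j → ¬ (Ks i ≐ Ks j)))

  τ : ℕ → VSet G → OSepSet
  τ k X A B = InSk k A B × (X ⊆ B)

{-# OPTIONS --safe #-}
module Submission where

-- Because X is critical, every finite vertex set Z is avoided by one of the
-- infinitely many components K of G - X with N(K) = X (pigeonhole on |Z| + 1
-- of them).  A connected K avoiding the separator A ∩ B of (A , B) cannot
-- meet A while a neighbour of K lies outside A, so choosing K to avoid A ∩ B
-- puts all of X = N(K) inside A or inside B: τ orients S_k(G), and uniquely
-- and consistently because |X| ≥ k exceeds the order of every separator.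
-- Separators of a star lie in its interior, so for a star σ ⊆ τ we may choose
-- K avoiding int(σ); a vertex of K outside int(σ) lies in A ∖ B for some
-- (A , B) ∈ σ, while X ⊆ B ⊈ A, forcing K to meet A ∩ B.  Finally the
-- component of G - Y containing a K that avoids Y contains X ∖ Y.

open import Defs
open import Level using (Level)
open import Data.Nat using (ℕ; suc; _≤_; _≥_; _≤?_)
open import Data.Nat.Properties using (≤-trans; <-≤-trans; ≰⇒>; n≮n)
open import Data.Fin as Fin using (Fin)
open import Data.Fin.Properties using (pigeonhole; <⇒≢)
open import Data.Product using (_×_; ∃; ∃₂; Σ; _,_; proj₁; proj₂; swap)
open import Data.Sum as Sum using (_⊎_; inj₁; inj₂)
open import Data.Empty using (⊥; ⊥-elim)
open import Data.List using (length; lookup)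
open import Data.List.Relation.Unary.Any using (index)
open import Data.List.Relation.Unary.Any.Properties using (lookup-index)
open import Function using (_∘_)
open import Relation.Nullary using (¬_; yes; no)
open import Relation.Nullary.Decidable using (decidable-stable)
open import Relation.Binary.PropositionalEquality using (_≡_; _≢_; refl; sym; trans; subst)
open import Relation.Unary using (Pred; _∈_; _∉_; _⊆_; _∩_; _∪_; ∁; _≬_)
open import Axiom.ExcludedMiddle using (ExcludedMiddle)

module _ (G : Graph) where
  open Graph G using (V; E)

  SizeAtMost : ∀ {ℓ} → Pred V ℓ → ℕ → Set ℓ
  SizeAtMost Z m = Σ (Fin m → V) λ g → ∀ v → v ∈ Z → ∃ λ j → g j ≡ v

  HasSize⇒SizeAtMost : ∀ {Z n} → HasSize G Z n → SizeAtMost Z n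
  HasSize⇒SizeAtMost (f , _ , member) = f , λ v v∈Z → proj₁ (member v) v∈Z

  Finite⇒SizeAtMost : ∀ {ℓ} {Z : Pred V ℓ} → Finite G Z → ∃ (SizeAtMost Z)
  Finite⇒SizeAtMost (xs , listed) =
    length xs , lookup xs , λ v v∈Z → index (listed v v∈Z) , sym (lookup-index (listed v v∈Z))

  disjoint-meeting⇒≤ : ∀ {ℓ n m} {Z : Pred V ℓ} (Ks : Fin n → VSet G)
    → (∀ i j → i ≢ j → ∀ v → v ∈ Ks i → v ∈ Ks j → ⊥)
    → (∀ i → Ks i ≬ Z) → SizeAtMost Z m → n ≤ m
  disjoint-meeting⇒≤ {n = n} {m} Ks disjoint meets (g , cover) with n ≤? m
  ... | yes n≤m = n≤m
  ... | no n≰m = ⊥-elim (collision (pigeonhole (≰⇒> n≰m) slot))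
    where
    slot : Fin n → Fin m
    slot i = proj₁ (cover _ (proj₂ (proj₂ (meets i))))

    hits : ∀ i → g (slot i) ∈ Ks i
    hits i = subst (Ks i) (sym (proj₂ (cover _ (proj₂ (proj₂ (meets i)))))) (proj₁ (proj₂ (meets i)))

    collision : ¬ (∃₂ λ i j → i Fin.< j × slot i ≡ slot j)
    collision (i , j , i<j , same) =
      disjoint i j (<⇒≢ i<j) _ (hits i) (subst (λ s → g s ∈ Ks j) (sym same) (hits j))

  HasSize⊆⇒≤ : ∀ {ℓ n m} {X : VSet G} {Z : Pred V ℓ} → HasSize G X n → X ⊆ Z → SizeAtMost Z m → n ≤ m
  HasSize⊆⇒≤ (f , injective , member) X⊆Z =
    disjoint-meeting⇒≤ (λ i v → f i ≡ v)
      (λ i j i≢j v fi≡v fj≡v → i≢j (injective (trans fi≡v (sym fj≡v))))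
      (λ i → f i , refl , X⊆Z (proj₂ (member (f i)) i refl))

  HasSize-resp-≐ : ∀ {A B n} → _≐_ G A B → HasSize G A n → HasSize G B n
  HasSize-resp-≐ (A⊆B , B⊆A) (f , injective , member) =
    f , injective , λ v → proj₁ (member v) ∘ B⊆A , λ i fi≡v → A⊆B (proj₂ (member v) i fi≡v)

  IsSep-swap : ∀ {A B} → IsSep G A B → IsSep G B A
  IsSep-swap (cover , no-edge) =
    Sum.swap ∘ cover , λ u v u∈B u∉A v∈A v∉B Euv → no-edge v u v∈A v∉B u∈B u∉A (Graph.sym G Euv)

  IsSep-resp-≐ : ∀ {A B C D} → _≐_ G A C → _≐_ G B D → IsSep G A B → IsSep G C D
  IsSep-resp-≐ (A⊆C , C⊆A) (B⊆D , D⊆B) (cover , no-edge) =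
    Sum.map A⊆C B⊆D ∘ cover ,
    λ u v u∈C u∉D v∈D v∉C → no-edge u v (C⊆A u∈C) (u∉D ∘ B⊆D) (D⊆B v∈D) (v∉C ∘ A⊆C)

  ∉B⇒∈A : ∀ {A B x} → IsSep G A B → x ∉ B → x ∈ A
  ∉B⇒∈A (cover , _) x∉B = Sum.[ (λ x∈A → x∈A) , ⊥-elim ∘ x∉B ] (cover _)

  InSk-swap : ∀ {k A B} → InSk G k A B → InSk G k B A
  InSk-swap (sep , m , m<k , size) = IsSep-swap sep , m , m<k , HasSize-resp-≐ (swap , swap) size

  InSk-resp-≐ : ∀ {k A B C D} → _≐_ G A C → _≐_ G B D → InSk G k A B → InSk G k C D
  InSk-resp-≐ A≐C@(A⊆C , C⊆A) B≐D@(B⊆D , D⊆B) (sep , m , m<k , size) =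
    IsSep-resp-≐ A≐C B≐D sep , m , m<k ,
    HasSize-resp-≐ ((λ (a , b) → A⊆C a , B⊆D b) , λ (c , d) → C⊆A c , D⊆B d) size

  PathIn-end : ∀ {S u v} → PathIn G S u v → v ∈ S
  PathIn-end (here v∈S) = v∈S
  PathIn-end (step _ _ p) = PathIn-end p

  PathIn-start : ∀ {S u v} → PathIn G S u v → u ∈ S
  PathIn-start (here u∈S) = u∈S
  PathIn-start (step u∈S _ _) = u∈S

  PathIn-snoc : ∀ {S u v w} → PathIn G S u v → E v w → w ∈ S → PathIn G S u w
  PathIn-snoc (here v∈S) Evw w∈S = step v∈S Evw (here w∈S)
  PathIn-snoc (step u∈S Eux p) Evw w∈S = step u∈S Eux (PathIn-snoc p Evw w∈S)

  PathIn-++ : ∀ {S u v w} → PathIn G S u v → PathIn G S v w → PathIn G S u w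
  PathIn-++ (here _) q = q
  PathIn-++ (step u∈S Eux p) q = step u∈S Eux (PathIn-++ p q)

  PathIn-reverse : ∀ {S u v} → PathIn G S u v → PathIn G S v u
  PathIn-reverse (here u∈S) = here u∈S
  PathIn-reverse (step u∈S Eux p) = PathIn-snoc (PathIn-reverse p) (Graph.sym G Eux) u∈S

  PathIn-mono : ∀ {S T u v} → S ⊆ T → PathIn G S u v → PathIn G T u v
  PathIn-mono S⊆T (here u∈S) = here (S⊆T u∈S)
  PathIn-mono S⊆T (step u∈S Eux p) = step (S⊆T u∈S) Eux (PathIn-mono S⊆T p)

  component-connected : ∀ {Y K u v} → IsComponent G Y K → u ∈ K → v ∈ K → PathIn G K u v
  component-connected {Y} {K} (_ , _ , connected , closed) u∈K v∈K = within u∈K (connected _ _ u∈K v∈K)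
    where
    within : ∀ {u v} → u ∈ K → PathIn G (∁ Y) u v → PathIn G K u v
    within u∈K (here _) = here u∈K
    within u∈K (step u∉Y Eux p) =
      step u∈K Eux (within (closed _ _ u∈K (step u∉Y Eux (here (PathIn-start p)))) p)

  component-≐ : ∀ {Y K L v} → IsComponent G Y K → IsComponent G Y L → v ∈ K → v ∈ L → _≐_ G K L
  component-≐ (_ , _ , connectedK , closedK) (_ , _ , connectedL , closedL) v∈K v∈L =
      (λ u∈K → closedL _ _ v∈L (connectedK _ _ v∈K u∈K))
    , (λ u∈L → closedK _ _ v∈K (connectedL _ _ v∈L u∈L))

  reachable-isComponent : ∀ {Y a} → a ∉ Y → IsComponent G Y (PathIn G (∁ Y) a)
  reachable-isComponent a∉Y =
    PathIn-end , (_ , here a∉Y) , (λ _ _ p q → PathIn-++ (PathIn-reverse p) q) , λ _ _ → PathIn-++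

  ∁-∩-∪-≐ : ∀ {Y K} → K ⊆ ∁ Y → _≐_ G Y (∁ K ∩ (K ∪ Y))
  ∁-∩-∪-≐ K⊆∁Y = (λ v∈Y → (λ v∈K → K⊆∁Y v∈K v∈Y) , inj₂ v∈Y)
               , λ { (v∉K , inj₁ v∈K) → ⊥-elim (v∉K v∈K) ; (_ , inj₂ v∈Y) → v∈Y }

module _ (lem : ∀ {ℓ} → ExcludedMiddle ℓ) (G : Graph) where
  open Graph G using (V; E)

  ¬⊆⇒∃ : ∀ {ℓ₁ ℓ₂} {P : Pred V ℓ₁} {Q : Pred V ℓ₂} → ¬ (P ⊆ Q) → ∃ λ v → v ∈ P × v ∉ Q
  ¬⊆⇒∃ P⊈Q = decidable-stable lem λ none →
    P⊈Q λ {v} v∈P → decidable-stable lem λ v∉Q → none (v , v∈P , v∉Q)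

  ∉int⇒∃ : ∀ {σ v} → v ∉ int G σ → ∃₂ λ A B → σ A B × v ∉ B
  ∉int⇒∃ v∉int = decidable-stable lem λ none →
    v∉int λ A B σAB → decidable-stable lem λ v∉B → none (A , B , σAB , v∉B)

  ∉B⇒neighbour∈A : ∀ {A B x u} → IsSep G A B → x ∉ B → E u x → u ∈ A
  ∉B⇒neighbour∈A {u = u} sep@(_ , no-edge) x∉B Eux = decidable-stable lem λ u∉A →
    no-edge _ u (∉B⇒∈A G sep x∉B) x∉B (∉B⇒∈A G (IsSep-swap G sep) u∉A) u∉A (Graph.sym G Eux)

  path-meets-separator : ∀ {S A B u v} → IsSep G A B → PathIn G S u v → u ∈ A → v ∈ B → S ≬ (A ∩ B)
  path-meets-separator sep (here u∈S) u∈A u∈B = _ , u∈S , u∈A , u∈B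
  path-meets-separator {B = B} {u} sep (step u∈S Euw p) u∈A v∈B with lem {P = u ∈ B}
  ... | yes u∈B = u , u∈S , u∈A , u∈B
  ... | no u∉B = path-meets-separator sep p (∉B⇒neighbour∈A sep u∉B (Graph.sym G Euw)) v∈B

  component-meets-separator : ∀ {A B Y K u x} → IsSep G A B → IsComponent G Y K
    → u ∈ K → u ∈ A → x ∈ Nbhd G K → x ∉ A → K ≬ (A ∩ B)
  component-meets-separator sep K-comp u∈K u∈A (_ , u′ , u′∈K , Eu′x) x∉A =
    path-meets-separator sep (component-connected G K-comp u∈K u′∈K) u∈A
      (∉B⇒neighbour∈A (IsSep-swap G sep) x∉A Eu′x)

  component-isSep : ∀ {Y K} → IsComponent G Y K → IsSep G (∁ K) (K ∪ Y)
  component-isSep {Y} {K} (K⊆∁Y , _ , _ , closed) = cover , no-edge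
    where
    cover : ∀ v → v ∈ ∁ K ⊎ v ∈ K ∪ Y
    cover v with lem {P = v ∈ K}
    ... | yes v∈K = inj₂ (inj₁ v∈K)
    ... | no v∉K = inj₁ v∉K

    no-edge : ∀ u v → u ∈ ∁ K → u ∉ K ∪ Y → v ∈ K ∪ Y → v ∉ ∁ K → ¬ E u v
    no-edge u v u∉K u∉K∪Y (inj₁ v∈K) _ Euv =
      u∉K (closed v u v∈K (step (K⊆∁Y v∈K) (Graph.sym G Euv) (here (u∉K∪Y ∘ inj₂))))
    no-edge u v _ _ (inj₂ v∈Y) ¬v∉K _ = ¬v∉K λ v∈K → K⊆∁Y v∈K v∈Y

  star-separator⊆int : ∀ {σ A B} → IsStar G σ → σ A B → A ∩ B ⊆ int G σ
  star-separator⊆int (_ , _ , nested) σAB {w} (w∈A , w∈B) C D σCD = decidable-stable lem λ w∉D →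
    w∉D (proj₁ (nested _ _ C D σAB σCD λ same → w∉D (proj₁ (proj₂ same) w∈B)) w∈A)

  critical-component-avoiding : ∀ {ℓ m X} {Z : Pred V ℓ} → Critical G X → SizeAtMost G Z m
    → ∃ λ K → IsComponent G X K × X ⊆ Nbhd G K × ¬ (K ≬ Z)
  critical-component-avoiding {m = m} {Z = Z} (_ , many) |Z|≤m with many (suc m)
  ... | Ks , components , distinct with lem {P = ∃ λ i → ¬ (Ks i ≬ Z)}
  ... | yes (i , Kᵢ-avoids) = Ks i , proj₁ (components i) , proj₂ (proj₂ (components i)) , Kᵢ-avoids
  ... | no none-avoids = ⊥-elim (n≮n m (disjoint-meeting⇒≤ G Ks disjoint meets |Z|≤m))
    where
    disjoint : ∀ i j → i ≢ j → ∀ v → v ∈ Ks i → v ∈ Ks j → ⊥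
    disjoint i j i≢j v v∈Kᵢ v∈Kⱼ =
      distinct i j i≢j (component-≐ G (proj₁ (components i)) (proj₁ (components j)) v∈Kᵢ v∈Kⱼ)

    meets : ∀ i → Ks i ≬ Z
    meets i = decidable-stable lem λ Kᵢ-avoids → none-avoids (i , Kᵢ-avoids)

module CriticalTangle (lem : ∀ {ℓ} → ExcludedMiddle ℓ) (G : Graph) {k : ℕ} {X : VSet G}
  (critical : Critical G X) (large : ∃ λ n → n ≥ k × HasSize G X n) where

  X⊈separator : ∀ {A B} → InSk G k A B → ¬ (X ⊆ A ∩ B)
  X⊈separator (_ , m , m<k , |A∩B|≡m) X⊆A∩B =
    let _ , k≤n , |X|≡n = large in
    n≮n m (<-≤-trans m<k (≤-trans k≤n (HasSize⊆⇒≤ G |X|≡n X⊆A∩B (HasSize⇒SizeAtMost G |A∩B|≡m))))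

  τ-resp-≐ : ∀ A B C D → τ G k X A B → _≐_ G A C → _≐_ G B D → τ G k X C D
  τ-resp-≐ _ _ _ _ (AB∈Sk , X⊆B) A≐C B≐D@(B⊆D , _) = InSk-resp-≐ G A≐C B≐D AB∈Sk , B⊆D ∘ X⊆B

  τ-dichotomy : ∀ A B → InSk G k A B → τ G k X A B ⊎ τ G k X B A
  τ-dichotomy A B AB∈Sk@(sep , _ , _ , |A∩B|≡m) with lem {P = X ⊆ B} | lem {P = X ⊆ A}
  ... | yes X⊆B | _ = inj₁ (AB∈Sk , X⊆B)
  ... | no _ | yes X⊆A = inj₂ (InSk-swap G AB∈Sk , X⊆A)
  ... | no X⊈B | no X⊈A
    with critical-component-avoiding lem G critical (HasSize⇒SizeAtMost G |A∩B|≡m)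
       | ¬⊆⇒∃ lem G X⊈B | ¬⊆⇒∃ lem G X⊈A
  ... | K , K-comp , X⊆N[K] , K-avoids | x , x∈X , x∉B | y , y∈X , y∉A
    with X⊆N[K] x∈X
  ... | _ , u , u∈K , Eux =
    ⊥-elim (K-avoids (component-meets-separator lem G sep K-comp u∈K
                        (∉B⇒neighbour∈A lem G sep x∉B Eux) (X⊆N[K] y∈X) y∉A))

  τ-isOrientation : IsOrientation G k (τ G k X)
  τ-isOrientation =
      (λ _ _ → proj₁) , τ-resp-≐
    , λ A B AB∈Sk → τ-dichotomy A B AB∈Sk
                  , λ τAB τBA → ⊥-elim (X⊈separator AB∈Sk λ x∈X → proj₂ τBA x∈X , proj₂ τAB x∈X)

  τ-consistent : Consistent G (τ G k X)
  τ-consistent _ _ _ _ _ ((_ , D⊆B) , _) (BA∈Sk , X⊆A) (_ , X⊆D) =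
    X⊈separator BA∈Sk λ x∈X → D⊆B (X⊆D x∈X) , X⊆A x∈X

  τ-excludes-star : ∀ {σ} → IsStar G σ → Finite G (int G σ) → ¬ (∀ A B → σ A B → τ G k X A B)
  τ-excludes-star {σ} star int-finite σ⊆τ
    with Finite⇒SizeAtMost G int-finite
  ... | _ , |int|≤m
    with critical-component-avoiding lem G critical |int|≤m
  ... | K , K-comp@(_ , (v , v∈K) , _) , X⊆N[K] , K-avoids
    with ∉int⇒∃ lem G (λ v∈int → K-avoids (v , v∈K , v∈int))
  ... | A , B , σAB , v∉B
    with σ⊆τ A B σAB
  ... | AB∈Sk@(sep , _) , X⊆B
    with ¬⊆⇒∃ lem G {P = X} {Q = A} (λ X⊆A → X⊈separator AB∈Sk λ x∈X → X⊆A x∈X , X⊆B x∈X)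
  ... | x , x∈X , x∉A
    with component-meets-separator lem G sep K-comp v∈K (∉B⇒∈A G sep v∉B) (X⊆N[K] x∈X) x∉A
  ... | w , w∈K , w∈A∩B = K-avoids (w , w∈K , star-separator⊆int lem G star σAB w∈A∩B)

  τ-principal : Principal G k (τ G k X)
  τ-principal Y (m , m<k , |Y|≡m)
    with critical-component-avoiding lem G critical (HasSize⇒SizeAtMost G |Y|≡m)
  ... | K , K-comp@(_ , (a , a∈K) , _) , X⊆N[K] , K-avoids =
    C , C-comp , (component-isSep lem G C-comp , m , m<k , HasSize-resp-≐ G (∁-∩-∪-≐ G (PathIn-end G)) |Y|≡m) , X⊆C∪Y
    where
    K⊆∁Y : K ⊆ ∁ Y
    K⊆∁Y v∈K v∈Y = K-avoids (_ , v∈K , v∈Y)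

    C : VSet G
    C = PathIn G (∁ Y) a

    C-comp : IsComponent G Y C
    C-comp = reachable-isComponent G (K⊆∁Y a∈K)

    X⊆C∪Y : X ⊆ C ∪ Y
    X⊆C∪Y {x} x∈X with lem {P = x ∈ Y} | X⊆N[K] x∈X
    ... | yes x∈Y | _ = inj₂ x∈Y
    ... | no x∉Y | _ , u , u∈K , Eux =
      inj₁ (PathIn-snoc G (PathIn-mono G K⊆∁Y (component-connected G K-comp a∈K u∈K)) Eux x∉Y)

lemma3p7 : (lem : ∀ {ℓ : Level} → ExcludedMiddle ℓ)
    (G : Graph) (k : ℕ) (F : OSepSet G → Set)
    → (∀ σ → F σ → IsStar G σ × (∀ A B → σ A B → InSk G k A B) × Finite G (int G σ))
    → (X : VSet G) → Critical G X → (∃ λ n → n ≥ k × HasSize G X n)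
    → (IsFTangle G k F (τ G k X) × Principal G k (τ G k X))
      × (∀ σ → IsStar G σ → (∀ A B → σ A B → InSk G k A B) → X ⊆ int G σ
           → ∀ A B → σ A B → τ G k X A B)
lemma3p7 lem G k F F-stars X critical large =
    ((τ-isOrientation , τ-consistent , F-excluded) , τ-principal)
  , λ σ _ σ⊆Sk X⊆int A B σAB → σ⊆Sk A B σAB , λ x∈X → X⊆int x∈X A B σAB
  where
  open CriticalTangle lem G critical large

  F-excluded : ∀ σ → F σ → ¬ (∀ A B → σ A B → τ G k X A B)
  F-excluded σ σ∈F with F-stars σ σ∈F
  ... | star , _ , int-finite = τ-excludes-star star int-finite
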